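{- $\mathrm{Im}\,\sharp$ is a proper subalgebra of $U(\mathfrak{sl}_2)_e$, i.e. it is a subalgebra of $U(\mathfrak{sl}_2)_e$ that is neither equal to $U(\mathfrak{sl}_2)_e$ nor equal to the subalgebra generated by the unit.
   Context: $U(\mathfrak{sl}_2)$ is the $\mathbb C$-algebra generated by $E,F,H$ subject to $[H,E]=2E$, $[H,F]=-2F$, $[E,F]=H$ ($[x,y]=xy-yx$, $\mathbf i=\sqrt{ -1}$). For $n\in\mathbb Z$ let $U_n$ be the span of all $E^iF^jH^k$ ($i,j,k\in\mathbb N$, $i-j=n$); the even subalgebra is $U(\mathfrak{sl}_2)_e=\bigoplus_{n\in\mathbb Z}U_{2n}$. The universal Racah algebra $\Re$ is generated by $A,B,C,\Delta$ subject to $[A,B]=[B,C]=[C,A]=2\Delta$ and the requirement that each of $[A,\Delta]+AC-BA$, $[B,\Delta]+BA-CB$, $[C,\Delta]+CB-AC$ is central. $\sharp:\Re\to U(\mathfrak{sl}_2)$ is the algebra homomorphism with $A\mapsto \frac{(E+F-2)(E+F+2)}{16}$, $B\mapsto\frac{(H-2)(H+2)}{16}$, $C\mapsto \frac{(\mathbf iE-\mathbf iF-2)(\mathbf iE-\mathbf iF+2)}{16}$, $\Delta\mapsto\frac{(H+2)F^2-(H-2)E^2}{64}$. -}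

module Defs where

open import Level using (0ℓ)
open import Algebra.Bundles using (CommutativeRing; Ring)
open import Algebra.Morphism.Structures using (module RingMorphisms)
open import Data.Nat using (ℕ; zero; suc)
open import Data.Integer using (ℤ; +_) renaming (_-_ to _-ℤ_; _*_ to _*ℤ_)
open import Data.Product using (Σ; ∃; _×_; _,_)
open import Data.Fin using (Fin; zero; suc)
open import Relation.Nullary using (¬_)

record Field : Set₁ where
  field
    cring : CommutativeRing 0ℓ 0ℓ
  open CommutativeRing cring public
  field
    1≉0     : ¬ (1# ≈ 0#)
    inverse : ∀ x → ¬ (x ≈ 0#) → ∃ λ y → x * y ≈ 1#

numeral : {A : Set} → A → A → (A → A → A) → ℕ → A
numeral z o _+_ zero    = z
numeral z o _+_ (suc n) = o + numeral z o _+_ n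

power : {A : Set} → A → (A → A → A) → A → ℕ → A
power o _*_ x zero    = o
power o _*_ x (suc n) = x * power o _*_ x n

module _ (K : Field) where
  open Field K

  CharZero : Set
  CharZero = ∀ n → ¬ (numeral 0# 1# _+_ (suc n) ≈ 0#)

record KAlgebra (K : Field) : Set₁ where
  field
    algRing : Ring 0ℓ 0ℓ
  open Ring algRing public
  field
    ι         : Field.Carrier K → Carrier
    ι-hom     : RingMorphisms.IsRingHomomorphism
                  (CommutativeRing.rawRing (Field.cring K)) rawRing ι
    ι-central : ∀ k x → ι k * x ≈ x * ι k

record IsKAlgHom {K : Field} (A B : KAlgebra K)
                 (φ : KAlgebra.Carrier A → KAlgebra.Carrier B) : Set where
  field
    ring-hom : RingMorphisms.IsRingHomomorphism
                 (KAlgebra.rawRing A) (KAlgebra.rawRing B) φ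
    ι-comm   : ∀ k → KAlgebra._≈_ B (φ (KAlgebra.ι A k)) (KAlgebra.ι B k)

module _ {K : Field} (A : KAlgebra K) where
  open KAlgebra A

  [_,_] : Carrier → Carrier → Carrier
  [ x , y ] = x * y - y * x

  record Sl2Rel (E F H : Carrier) : Set where
    field
      HE : [ H , E ] ≈ E + E
      HF : [ H , F ] ≈ - (F + F)
      EF : [ E , F ] ≈ H

record IsUsl2 {K : Field} (U : KAlgebra K) (E F H : KAlgebra.Carrier U) : Set₁ where
  field
    rel       : Sl2Rel U E F H
    lift      : (R : KAlgebra K) (e f h : KAlgebra.Carrier R) → Sl2Rel R e f h →
                Σ (KAlgebra.Carrier U → KAlgebra.Carrier R) λ φ →
                  IsKAlgHom U R φ × KAlgebra._≈_ R (φ E) e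
                  × KAlgebra._≈_ R (φ F) f × KAlgebra._≈_ R (φ H) h
    lift-uniq : (R : KAlgebra K) (φ ψ : KAlgebra.Carrier U → KAlgebra.Carrier R) →
                IsKAlgHom U R φ → IsKAlgHom U R ψ →
                KAlgebra._≈_ R (φ E) (ψ E) → KAlgebra._≈_ R (φ F) (ψ F) →
                KAlgebra._≈_ R (φ H) (ψ H) →
                ∀ x → KAlgebra._≈_ R (φ x) (ψ x)

module _ {K : Field} (A : KAlgebra K) where
  open KAlgebra A

  data InSubalg {n : ℕ} (g : Fin n → Carrier) : Carrier → Set where
    scal : ∀ k → InSubalg g (ι k)
    gen  : ∀ j → InSubalg g (g j)
    add  : ∀ {x y} → InSubalg g x → InSubalg g y → InSubalg g (x + y)
    mul  : ∀ {x y} → InSubalg g x → InSubalg g y → InSubalg g (x * y)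
    resp : ∀ {x y} → x ≈ y → InSubalg g x → InSubalg g y

  data InMonoSpan (E F H : Carrier) (P : ℕ → ℕ → ℕ → Set) : Carrier → Set where
    zer : InMonoSpan E F H P 0#
    mono : ∀ c i j k → P i j k →
           InMonoSpan E F H P (ι c * (power 1# _*_ E i * (power 1# _*_ F j * power 1# _*_ H k)))
    add  : ∀ {x y} → InMonoSpan E F H P x → InMonoSpan E F H P y → InMonoSpan E F H P (x + y)
    resp : ∀ {x y} → x ≈ y → InMonoSpan E F H P x → InMonoSpan E F H P y

-- The even subalgebra U_e = ⊕_n U_{2n}, and the image of ♯.
--   i   : a square root of -1 in K
--   q16 : 1/16 in K,  q64 : 1/64 in K

module Sharp (K : Field) (i q16 q64 : Field.Carrier K)
             (U : KAlgebra K) (E F H : KAlgebra.Carrier U) where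
  open KAlgebra U

  EvenIdx : ℕ → ℕ → ℕ → Set
  EvenIdx a b c = ∃ λ (m : ℤ) → (+ a) -ℤ (+ b) ≡ (+ 2) *ℤ m
    where open import Relation.Binary.PropositionalEquality using (_≡_)

  InUe : Carrier → Set
  InUe = InMonoSpan U E F H EvenIdx

  two : Carrier
  two = 1# + 1#

  sq : Carrier → Carrier
  sq x = x * x

  A♯ B♯ C♯ Δ♯ : Carrier
  A♯ = ι q16 * ((E + F - two) * (E + F + two))
  B♯ = ι q16 * ((H - two) * (H + two))
  C♯ = ι q16 * ((ι i * E - ι i * F - two) * (ι i * E - ι i * F + two))
  Δ♯ = ι q64 * ((H + two) * sq F - (H - two) * sq E)

  gens : Fin 4 → Carrier
  gens zero                   = A♯
  gens (suc zero)             = B♯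
  gens (suc (suc zero))       = C♯
  gens (suc (suc (suc zero))) = Δ♯

  InIm : Carrier → Set
  InIm = InSubalg U gens

{-# OPTIONS --safe #-}
module Submission where

-- Grade the monomial E^a F^b H^k by the parity of a + b (equivalently of a - b).
-- Left multiplication by E or F flips the grade and by H preserves it (the latter
-- because ad H acts on E^a and F^b by scalars), so the grading is multiplicative
-- and U_e is its even part.  The four generators of Im ♯ are even, whence
-- Im ♯ ⊆ U_e.  The automorphism σ of U(sl₂) exchanging E and F and negating H
-- fixes all four generators, hence all of Im ♯, while σ H = - H ≠ H; so
-- H ∈ U_e ∖ Im ♯.  Finally ♯(B) = (H² - 4)/16 is not a scalar: on the
-- 3-dimensional irreducible representation, where H acts as diag(2, 0, -2), it
-- has eigenvalues 0 and -1/4 (the same representation shows - H ≠ H).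

open import Defs
open import Algebra.Morphism.Structures using (module RingMorphisms)
open import Algebra.Structures using (IsRing)
import Algebra.Properties.Ring as RingProperties
open import Data.Nat.Base using (ℕ; zero; suc; parity) renaming (_+_ to _+ℕ_)
open import Data.Nat.Properties using (+-suc)
open import Data.Parity.Base as ℙ using (Parity; 0ℙ; 1ℙ; _⁻¹)
import Data.Parity.Properties as ℙₚ
open import Data.Integer.Base as ℤ using (+_)
open import Data.Integer.Tactic.RingSolver using (solve-∀)
open import Data.Product.Base using (∃; _×_; _,_; proj₁; proj₂)
open import Data.Fin.Base using (Fin)
open import Data.Fin.Patterns using (0F; 1F; 2F; 3F)
open import Function.Base using (id)
open import Relation.Nullary using (¬_)
open import Relation.Binary.PropositionalEquality as ≡ using (_≡_)
import Relation.Binary.Reasoning.Setoid as SetoidReasoning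

parity-suc : ∀ n → parity (suc n) ≡ parity n ⁻¹
parity-suc n = ℙₚ.+-homo-+ 1 n

parity-even⇒double : ∀ n → parity n ≡ 0ℙ → ∃ λ k → n ≡ k +ℕ k
parity-even⇒double zero          _ = 0 , ≡.refl
parity-even⇒double (suc (suc n)) e with parity-even⇒double n e
... | k , ≡.refl = suc k , ≡.cong suc (≡.sym (+-suc k k))

parity-even⇒evenDifference : ∀ a b → parity (a +ℕ b) ≡ 0ℙ →
                             ∃ λ m → + a ℤ.- + b ≡ + 2 ℤ.* m
parity-even⇒evenDifference a b e with parity-even⇒double (a +ℕ b) e
... | k , a+b≡k+k = + k ℤ.- + b , (begin
  + a ℤ.- + b                        ≡⟨ shift (+ a) (+ b) ⟩
  + (a +ℕ b) ℤ.- (+ b ℤ.+ + b)       ≡⟨ ≡.cong (λ n → + n ℤ.- (+ b ℤ.+ + b)) a+b≡k+k ⟩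
  + (k +ℕ k) ℤ.- (+ b ℤ.+ + b)       ≡⟨ halve (+ k) (+ b) ⟩
  + 2 ℤ.* (+ k ℤ.- + b)              ∎)
  where
  open ≡.≡-Reasoning
  shift : ∀ x y → x ℤ.- y ≡ (x ℤ.+ y) ℤ.- (y ℤ.+ y)
  shift = solve-∀
  halve : ∀ x y → (x ℤ.+ x) ℤ.- (y ℤ.+ y) ≡ + 2 ℤ.* (x ℤ.- y)
  halve = solve-∀

module KAlgebraProperties {K : Field} (A : KAlgebra K) where
  open KAlgebra A
  open RingProperties algRing
  open SetoidReasoning setoid
  open RingMorphisms.IsRingHomomorphism ι-hom
    using () renaming (+-homo to ι-+; 1#-homo to ι-1; 0#-homo to ι-0)
  private module K = Field K

  infixr 8 _^_
  _^_ : Carrier → ℕ → Carrier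
  x ^ n = power 1# _*_ x n

  two : Carrier
  two = 1# + 1#

  sq-4 : Carrier → Carrier
  sq-4 x = (x - two) * (x + two)

  ι1*x≈x : ∀ x → ι K.1# * x ≈ x
  ι1*x≈x x = trans (*-cong ι-1 refl) (*-identityˡ x)

  ι2*x≈x+x : ∀ x → ι (K.1# K.+ K.1#) * x ≈ x + x
  ι2*x≈x+x x = begin
    ι (K.1# K.+ K.1#) * x      ≈⟨ *-cong (ι-+ _ _) refl ⟩
    (ι K.1# + ι K.1#) * x      ≈⟨ distribʳ _ _ _ ⟩
    ι K.1# * x + ι K.1# * x    ≈⟨ +-cong (ι1*x≈x x) (ι1*x≈x x) ⟩
    x + x                      ∎

  *-ι-comm : ∀ c x y → x * (ι c * y) ≈ ι c * (x * y)
  *-ι-comm c x y = begin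
    x * (ι c * y)  ≈⟨ *-assoc _ _ _ ⟨
    x * ι c * y    ≈⟨ *-cong (ι-central c x) refl ⟨
    ι c * x * y    ≈⟨ *-assoc _ _ _ ⟩
    ι c * (x * y)  ∎

  x-y+y-z≈x-z : ∀ x y z → (x - y) + (y - z) ≈ x - z
  x-y+y-z≈x-z x y z = begin
    (x - y) + (y - z)    ≈⟨ +-assoc _ _ _ ⟩
    x + (- y + (y - z))  ≈⟨ +-cong refl (+-assoc _ _ _) ⟨
    x + ((- y + y) - z)  ≈⟨ +-cong refl (+-cong (-‿inverseˡ y) refl) ⟩
    x + (0# - z)         ≈⟨ +-cong refl (+-identityˡ _) ⟩
    x - z                ∎

  x-y≈z⇒x≈y+z : ∀ {x y z} → x - y ≈ z → x ≈ y + z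
  x-y≈z⇒x≈y+z {x} {y} {z} e = begin
    x                ≈⟨ +-identityʳ x ⟨
    x + 0#           ≈⟨ +-cong refl (-‿inverseˡ y) ⟨
    x + (- y + y)    ≈⟨ +-assoc _ _ _ ⟨
    (x - y) + y      ≈⟨ +-cong e refl ⟩
    z + y            ≈⟨ +-comm z y ⟩
    y + z            ∎

  difference-of-squares : ∀ x y → x * y ≈ y * x → (x - y) * (x + y) ≈ x * x - y * y
  difference-of-squares x y xy≈yx = begin
    (x - y) * (x + y)                    ≈⟨ distribˡ _ _ _ ⟩
    (x - y) * x + (x - y) * y            ≈⟨ +-cong ([y-z]x≈yx-zx _ _ _) ([y-z]x≈yx-zx _ _ _) ⟩
    (x * x - y * x) + (x * y - y * y)    ≈⟨ +-cong (+-cong refl (-‿cong xy≈yx)) refl ⟨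
    (x * x - x * y) + (x * y - y * y)    ≈⟨ x-y+y-z≈x-z _ _ _ ⟩
    x * x - y * y                        ∎

  two-central : ∀ x → x * two ≈ two * x
  two-central x = begin
    x * (1# + 1#)    ≈⟨ distribˡ _ _ _ ⟩
    x * 1# + x * 1#  ≈⟨ +-cong (*-identityʳ x) (*-identityʳ x) ⟩
    x + x            ≈⟨ +-cong (*-identityˡ x) (*-identityˡ x) ⟨
    1# * x + 1# * x  ≈⟨ distribʳ _ _ _ ⟨
    (1# + 1#) * x    ∎

  sq-4≈x²-4 : ∀ x → sq-4 x ≈ x * x - two * two
  sq-4≈x²-4 x = difference-of-squares x two (two-central x)

  sq-4-cong : ∀ {x y} → x ≈ y → sq-4 x ≈ sq-4 y
  sq-4-cong e = *-cong (+-cong e refl) (+-cong e refl)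

  sq-4-neg : ∀ x → sq-4 (- x) ≈ sq-4 x
  sq-4-neg x = begin
    sq-4 (- x)                  ≈⟨ sq-4≈x²-4 (- x) ⟩
    - x * - x - two * two       ≈⟨ +-cong (-‿distribʳ-* (- x) x) refl ⟨
    - (- x * x) - two * two     ≈⟨ +-cong (-‿cong (-‿distribˡ-* x x)) refl ⟨
    - - (x * x) - two * two     ≈⟨ +-cong (-‿involutive _) refl ⟩
    x * x - two * two           ≈⟨ sq-4≈x²-4 x ⟨
    sq-4 x                      ∎

  scalar-commutator-* : ∀ {h y c} → h * y ≈ y * h + ι c * y →
                        ∀ z → h * (y * z) ≈ y * (h * z) + ι c * (y * z)
  scalar-commutator-* {h} {y} {c} hy z = begin
    h * (y * z)                  ≈⟨ *-assoc _ _ _ ⟨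
    h * y * z                    ≈⟨ *-cong hy refl ⟩
    (y * h + ι c * y) * z        ≈⟨ distribʳ _ _ _ ⟩
    y * h * z + ι c * y * z      ≈⟨ +-cong (*-assoc _ _ _) (*-assoc _ _ _) ⟩
    y * (h * z) + ι c * (y * z)  ∎

  scalar-commutator-^ : ∀ {h x d} → h * x ≈ x * h + ι d * x →
                        ∀ n → ∃ λ c → h * x ^ n ≈ x ^ n * h + ι c * x ^ n
  scalar-commutator-^ {h} {x} {d} hx zero = K.0# , (begin
    h * 1#                ≈⟨ *-identityʳ h ⟩
    h                     ≈⟨ *-identityˡ h ⟨
    1# * h                ≈⟨ +-identityʳ _ ⟨
    1# * h + 0#           ≈⟨ +-cong refl (trans (*-cong ι-0 refl) (zeroˡ _)) ⟨
    1# * h + ι K.0# * 1#  ∎)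
  scalar-commutator-^ {h} {x} {d} hx (suc n) with scalar-commutator-^ hx n
  ... | c , ih = c K.+ d , (begin
    h * (x * xⁿ)                                      ≈⟨ scalar-commutator-* hx xⁿ ⟩
    x * (h * xⁿ) + ι d * (x * xⁿ)                     ≈⟨ +-cong (*-cong refl ih) refl ⟩
    x * (xⁿ * h + ι c * xⁿ) + ι d * (x * xⁿ)          ≈⟨ +-cong (distribˡ _ _ _) refl ⟩
    (x * (xⁿ * h) + x * (ι c * xⁿ)) + ι d * (x * xⁿ)
      ≈⟨ +-cong (+-cong (sym (*-assoc _ _ _)) (*-ι-comm c x xⁿ)) refl ⟩
    (x * xⁿ * h + ι c * (x * xⁿ)) + ι d * (x * xⁿ)    ≈⟨ +-assoc _ _ _ ⟩
    x * xⁿ * h + (ι c * (x * xⁿ) + ι d * (x * xⁿ))    ≈⟨ +-cong refl (distribʳ _ _ _) ⟨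
    x * xⁿ * h + (ι c + ι d) * (x * xⁿ)               ≈⟨ +-cong refl (*-cong (ι-+ c d) refl) ⟨
    x * xⁿ * h + ι (c K.+ d) * (x * xⁿ)               ∎)
    where
    xⁿ : Carrier
    xⁿ = x ^ n

module KAlgHomProperties {K : Field} {A B : KAlgebra K}
                         {φ : KAlgebra.Carrier A → KAlgebra.Carrier B}
                         (φ-hom : IsKAlgHom A B φ) where
  private
    module A = KAlgebra A
    module B = KAlgebra B
    module A′ = KAlgebraProperties A
    module B′ = KAlgebraProperties B
  open IsKAlgHom φ-hom public using (ι-comm)
  open RingMorphisms.IsRingHomomorphism (IsKAlgHom.ring-hom φ-hom) public
    using (⟦⟧-cong; +-homo; *-homo; 1#-homo; -‿homo)

  φ-two : φ A′.two B.≈ B′.two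
  φ-two = B.trans (+-homo A.1# A.1#) (B.+-cong 1#-homo 1#-homo)

  φ-sub : ∀ x y → φ (x A.- y) B.≈ φ x B.- φ y
  φ-sub x y = B.trans (+-homo x (A.- y)) (B.+-cong B.refl (-‿homo y))

  φ-ι* : ∀ k x → φ (A.ι k A.* x) B.≈ B.ι k B.* φ x
  φ-ι* k x = B.trans (*-homo (A.ι k) x) (B.*-cong (ι-comm k) B.refl)

  φ-sq-4 : ∀ x → φ (A′.sq-4 x) B.≈ B′.sq-4 (φ x)
  φ-sq-4 x = B.trans (*-homo _ _)
    (B.*-cong (B.trans (φ-sub x A′.two) (B.+-cong B.refl (B.-‿cong φ-two)))
              (B.trans (+-homo x A′.two) (B.+-cong B.refl φ-two)))

module ParityGrading {K : Field} {U : KAlgebra K} {E F H : KAlgebra.Carrier U}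
                     (rel : Sl2Rel U E F H) where
  open KAlgebra U
  open Sl2Rel rel
  open KAlgebraProperties U
  open RingProperties algRing
  open SetoidReasoning setoid
  open RingMorphisms.IsRingHomomorphism ι-hom using (*-homo; -‿homo; 1#-homo)
  private module K = Field K

  monomial : ℕ → ℕ → ℕ → Carrier
  monomial a b k = E ^ a * (F ^ b * H ^ k)

  Graded : Parity → Carrier → Set
  Graded p = InMonoSpan U E F H (λ a b _ → parity (a +ℕ b) ≡ p)

  monomial-graded : ∀ a b k → Graded (parity (a +ℕ b)) (monomial a b k)
  monomial-graded a b k = resp (ι1*x≈x _) (mono K.1# a b k ≡.refl)

  graded-subst : ∀ {p q x} → p ≡ q → Graded p x → Graded q x
  graded-subst {x = x} = ≡.subst (λ r → Graded r x)

  ι*-graded : ∀ {p x} c → Graded p x → Graded p (ι c * x)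
  ι*-graded c zer                = resp (sym (zeroʳ _)) zer
  ι*-graded c (mono d a b k eq)  =
    resp (trans (*-cong (*-homo c d) refl) (*-assoc _ _ _)) (mono (c K.* d) a b k eq)
  ι*-graded c (add s t)          = resp (sym (distribˡ _ _ _)) (add (ι*-graded c s) (ι*-graded c t))
  ι*-graded c (resp eq s)        = resp (*-cong refl eq) (ι*-graded c s)

  neg-graded : ∀ {p x} → Graded p x → Graded p (- x)
  neg-graded {x = x} s = resp -1x≈-x (ι*-graded (K.- K.1#) s)
    where
    -1x≈-x : ι (K.- K.1#) * x ≈ - x
    -1x≈-x = trans (*-cong (trans (-‿homo K.1#) (-‿cong 1#-homo)) refl) (-1*x≈-x x)

  sub-graded : ∀ {p x y} → Graded p x → Graded p y → Graded p (x - y)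
  sub-graded s t = add s (neg-graded t)

  leftMul-graded : (g : Carrier) (f : Parity → Parity) →
                   (∀ a b k → Graded (f (parity (a +ℕ b))) (g * monomial a b k)) →
                   ∀ {p x} → Graded p x → Graded (f p) (g * x)
  leftMul-graded g f g-mono zer                  = resp (sym (zeroʳ g)) zer
  leftMul-graded g f g-mono (mono c a b k ≡.refl) =
    resp (sym (*-ι-comm c g _)) (ι*-graded c (g-mono a b k))
  leftMul-graded g f g-mono (add s t)            =
    resp (sym (distribˡ _ _ _)) (add (leftMul-graded g f g-mono s) (leftMul-graded g f g-mono t))
  leftMul-graded g f g-mono (resp eq s)          = resp (*-cong refl eq) (leftMul-graded g f g-mono s)

  E*-graded : ∀ {p x} → Graded p x → Graded (p ⁻¹) (E * x)
  E*-graded = leftMul-graded E _⁻¹ λ a b k →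
    graded-subst (parity-suc (a +ℕ b)) (resp (*-assoc _ _ _) (monomial-graded (suc a) b k))

  HE-weight : H * E ≈ E * H + ι (K.1# K.+ K.1#) * E
  HE-weight = x-y≈z⇒x≈y+z (trans HE (sym (ι2*x≈x+x E)))

  HF-weight : H * F ≈ F * H + ι (K.- (K.1# K.+ K.1#)) * F
  HF-weight = x-y≈z⇒x≈y+z (trans HF (sym (trans (*-cong (-‿homo _) refl)
                              (trans (sym (-‿distribˡ-* _ _)) (-‿cong (ι2*x≈x+x F))))))

  H*-monomial : ∀ a b k → Graded (parity (a +ℕ b)) (H * monomial a b k)
  H*-monomial a b k with scalar-commutator-^ HE-weight a | scalar-commutator-^ HF-weight b
  ... | c , H*Eᵃ | d , H*Fᵇ =
    resp (sym H*M) (add (add (monomial-graded a b (suc k)) (ι*-graded d (monomial-graded a b k)))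
                        (ι*-graded c (monomial-graded a b k)))
    where
    M : Carrier
    M = monomial a b k
    H*M : H * M ≈ (monomial a b (suc k) + ι d * M) + ι c * M
    H*M = begin
      H * (E ^ a * (F ^ b * H ^ k))
        ≈⟨ scalar-commutator-* H*Eᵃ _ ⟩
      E ^ a * (H * (F ^ b * H ^ k)) + ι c * M
        ≈⟨ +-cong (*-cong refl (scalar-commutator-* H*Fᵇ _)) refl ⟩
      E ^ a * (F ^ b * H ^ suc k + ι d * (F ^ b * H ^ k)) + ι c * M
        ≈⟨ +-cong (distribˡ _ _ _) refl ⟩
      (monomial a b (suc k) + E ^ a * (ι d * (F ^ b * H ^ k))) + ι c * M
        ≈⟨ +-cong (+-cong refl (*-ι-comm d (E ^ a) _)) refl ⟩
      (monomial a b (suc k) + ι d * M) + ι c * M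
        ∎

  H*-graded : ∀ {p x} → Graded p x → Graded p (H * x)
  H*-graded = leftMul-graded H id H*-monomial

  F*-monomial : ∀ a b k → Graded (parity (a +ℕ b) ⁻¹) (F * monomial a b k)
  F*-monomial zero b k =
    resp (sym F*M) (graded-subst (parity-suc b) (monomial-graded 0 (suc b) k))
    where
    F*M : F * monomial 0 b k ≈ monomial 0 (suc b) k
    F*M = trans (*-cong refl (*-identityˡ _)) (trans (sym (*-assoc _ _ _)) (sym (*-identityˡ _)))
  F*-monomial (suc a) b k =
    resp (sym F*EM) (graded-subst (≡.sym (ℙₚ.suc-homo-⁻¹ (a +ℕ b)))
      (sub-graded (graded-subst (ℙₚ.⁻¹-involutive _) (E*-graded (F*-monomial a b k)))
                  (H*-monomial a b k)))
    where
    M : Carrier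
    M = monomial a b k
    F*EM : F * monomial (suc a) b k ≈ E * (F * M) - H * M
    F*EM = begin
      F * (E * E ^ a * (F ^ b * H ^ k))  ≈⟨ *-cong refl (*-assoc _ _ _) ⟩
      F * (E * M)                        ≈⟨ *-assoc _ _ _ ⟨
      F * E * M                          ≈⟨ *-cong (x-y≈z⇒x≈y+z EF′) refl ⟩
      (E * F - H) * M                    ≈⟨ [y-z]x≈yx-zx _ _ _ ⟩
      E * F * M - H * M                  ≈⟨ +-cong (*-assoc _ _ _) refl ⟩
      E * (F * M) - H * M                ∎
      where
      EF′ : F * E - E * F ≈ - H
      EF′ = trans (sym (⁻¹-anti-homo‿- _ _)) (-‿cong EF)

  F*-graded : ∀ {p x} → Graded p x → Graded (p ⁻¹) (F * x)
  F*-graded = leftMul-graded F _⁻¹ F*-monomial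

  ^*-graded-odd : ∀ {X} → (∀ {p x} → Graded p x → Graded (p ⁻¹) (X * x)) →
                  ∀ n {p x} → Graded p x → Graded (parity n ℙ.+ p) (X ^ n * x)
  ^*-graded-odd X* zero    s = resp (sym (*-identityˡ _)) s
  ^*-graded-odd X* (suc n) {p} s =
    graded-subst p⁺ (resp (sym (*-assoc _ _ _)) (X* (^*-graded-odd X* n s)))
    where
    p⁺ : (parity n ℙ.+ p) ⁻¹ ≡ parity (suc n) ℙ.+ p
    p⁺ = ≡.trans (≡.sym (ℙₚ.+-assoc 1ℙ (parity n) p)) (≡.cong (ℙ._+ p) (≡.sym (parity-suc n)))

  ^*-graded-even : ∀ {X} → (∀ {p x} → Graded p x → Graded p (X * x)) →
                   ∀ n {p x} → Graded p x → Graded p (X ^ n * x)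
  ^*-graded-even X* zero    s = resp (sym (*-identityˡ _)) s
  ^*-graded-even X* (suc n) s = resp (sym (*-assoc _ _ _)) (X* (^*-graded-even X* n s))

  monomial*-graded : ∀ a b k {q y} → Graded q y →
                     Graded (parity (a +ℕ b) ℙ.+ q) (monomial a b k * y)
  monomial*-graded a b k {q} s =
    graded-subst grade (resp reassoc
      (^*-graded-odd E*-graded a (^*-graded-odd F*-graded b (^*-graded-even H*-graded k s))))
    where
    grade : parity a ℙ.+ (parity b ℙ.+ q) ≡ parity (a +ℕ b) ℙ.+ q
    grade = ≡.trans (≡.sym (ℙₚ.+-assoc (parity a) (parity b) q))
                    (≡.cong (ℙ._+ q) (≡.sym (ℙₚ.+-homo-+ a b)))
    reassoc : ∀ {y} → E ^ a * (F ^ b * (H ^ k * y)) ≈ monomial a b k * y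
    reassoc = sym (trans (*-assoc _ _ _) (*-cong refl (*-assoc _ _ _)))

  *-graded : ∀ {p q x y} → Graded p x → Graded q y → Graded (p ℙ.+ q) (x * y)
  *-graded zer                   t = resp (sym (zeroˡ _)) zer
  *-graded (mono c a b k ≡.refl) t =
    resp (sym (*-assoc _ _ _)) (ι*-graded c (monomial*-graded a b k t))
  *-graded (add s s′)            t = resp (sym (distribʳ _ _ _)) (add (*-graded s t) (*-graded s′ t))
  *-graded (resp eq s)           t = resp (*-cong eq refl) (*-graded s t)

  1-even : Graded 0ℙ 1#
  1-even = resp (trans (*-identityˡ _) (*-identityˡ _)) (monomial-graded 0 0 0)

  two-even : Graded 0ℙ two
  two-even = add 1-even 1-even

  ι-even : ∀ c → Graded 0ℙ (ι c)
  ι-even c = resp (*-identityʳ _) (ι*-graded c 1-even)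

  E-odd : Graded 1ℙ E
  E-odd = resp (*-identityʳ E) (E*-graded 1-even)

  F-odd : Graded 1ℙ F
  F-odd = resp (*-identityʳ F) (F*-graded 1-even)

  H-even : Graded 0ℙ H
  H-even = resp (*-identityʳ H) (H*-graded 1-even)

  sq-4-even : ∀ {p x} → Graded p x → Graded 0ℙ (sq-4 x)
  sq-4-even {p} s = resp (sym (sq-4≈x²-4 _))
    (sub-graded (graded-subst (ℙₚ.p+p≡0ℙ p) (*-graded s s)) (*-graded two-even two-even))

module SharpImage (K : Field) (i q16 q64 : Field.Carrier K)
                  {U : KAlgebra K} {E F H : KAlgebra.Carrier U} (rel : Sl2Rel U E F H) where
  open KAlgebra U
  open Sharp K i q16 q64 U E F H
  open ParityGrading rel

  gens-even : ∀ j → Graded 0ℙ (gens j)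
  gens-even 0F = ι*-graded q16 (sq-4-even (add E-odd F-odd))
  gens-even 1F = ι*-graded q16 (sq-4-even H-even)
  gens-even 2F = ι*-graded q16 (sq-4-even (sub-graded (ι*-graded i E-odd) (ι*-graded i F-odd)))
  gens-even 3F =
    ι*-graded q64 (sub-graded (*-graded (add H-even two-even) (*-graded F-odd F-odd))
                              (*-graded (sub-graded H-even two-even) (*-graded E-odd E-odd)))

  Im♯-even : ∀ {x} → InIm x → Graded 0ℙ x
  Im♯-even (scal k)    = ι-even k
  Im♯-even (gen j)     = gens-even j
  Im♯-even (add s t)   = add (Im♯-even s) (Im♯-even t)
  Im♯-even (mul s t)   = *-graded (Im♯-even s) (Im♯-even t)
  Im♯-even (resp eq s) = resp eq (Im♯-even s)

  even⇒Ue : ∀ {x} → Graded 0ℙ x → InUe x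
  even⇒Ue zer                = zer
  even⇒Ue (mono c a b k eq)  = mono c a b k (parity-even⇒evenDifference a b eq)
  even⇒Ue (add s t)          = add (even⇒Ue s) (even⇒Ue t)
  even⇒Ue (resp eq s)        = resp eq (even⇒Ue s)

  Im♯⊆Ue : ∀ x → InIm x → InUe x
  Im♯⊆Ue _ s = even⇒Ue (Im♯-even s)

module LinearEndomorphisms (K : Field) (n : ℕ) where
  open Field K hiding (zero)
  open import Algebra.Properties.CommutativeSemigroup +-commutativeSemigroup using (interchange)

  Vec : Set
  Vec = Fin n → Carrier

  record Linear : Set where
    field
      apply       : Vec → Vec
      apply-cong  : ∀ {u v} → (∀ j → u j ≈ v j) → ∀ j → apply u j ≈ apply v j
      additive    : ∀ u v j → apply (λ l → u l + v l) j ≈ apply u j + apply v j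
      homogeneous : ∀ k u j → apply (λ l → k * u l) j ≈ k * apply u j
  open Linear public

  infix 4 _≈ₗ_
  record _≈ₗ_ (f g : Linear) : Set where
    constructor pointwise
    field at : ∀ v j → apply f v j ≈ apply g v j
  open _≈ₗ_ public

  0ₗ : Linear
  0ₗ = record
    { apply       = λ _ _ → 0#
    ; apply-cong  = λ _ _ → refl
    ; additive    = λ _ _ _ → sym (+-identityʳ _)
    ; homogeneous = λ _ _ _ → sym (zeroʳ _)
    }

  1ₗ : Linear
  1ₗ = record
    { apply       = λ v → v
    ; apply-cong  = λ e → e
    ; additive    = λ _ _ _ → refl
    ; homogeneous = λ _ _ _ → refl
    }

  infixl 6 _+ₗ_
  _+ₗ_ : Linear → Linear → Linear
  f +ₗ g = record
    { apply       = λ v j → apply f v j + apply g v j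
    ; apply-cong  = λ e j → +-cong (apply-cong f e j) (apply-cong g e j)
    ; additive    = λ u v j → trans (+-cong (additive f u v j) (additive g u v j)) (interchange _ _ _ _)
    ; homogeneous = λ k u j → trans (+-cong (homogeneous f k u j) (homogeneous g k u j)) (sym (distribˡ _ _ _))
    }

  -ₗ_ : Linear → Linear
  -ₗ f = record
    { apply       = λ v j → - apply f v j
    ; apply-cong  = λ e j → -‿cong (apply-cong f e j)
    ; additive    = λ u v j → trans (-‿cong (additive f u v j)) (sym (-‿+-comm _ _))
    ; homogeneous = λ k u j → trans (-‿cong (homogeneous f k u j)) (-‿distribʳ-* _ _)
    }
    where open RingProperties ring using (-‿+-comm; -‿distribʳ-*)

  infixl 7 _∘ₗ_
  _∘ₗ_ : Linear → Linear → Linear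
  f ∘ₗ g = record
    { apply       = λ v → apply f (apply g v)
    ; apply-cong  = λ e → apply-cong f (apply-cong g e)
    ; additive    = λ u v j → trans (apply-cong f (additive g u v) j) (additive f (apply g u) (apply g v) j)
    ; homogeneous = λ k u j → trans (apply-cong f (homogeneous g k u) j) (homogeneous f k (apply g u) j)
    }

  scalar : Carrier → Linear
  scalar k = record
    { apply       = λ v j → k * v j
    ; apply-cong  = λ e j → *-cong refl (e j)
    ; additive    = λ _ _ _ → distribˡ _ _ _
    ; homogeneous = λ l _ _ → trans (sym (*-assoc _ _ _)) (trans (*-cong (*-comm k l) refl) (*-assoc _ _ _))
    }

  isRingₗ : IsRing _≈ₗ_ _+ₗ_ _∘ₗ_ -ₗ_ 0ₗ 1ₗ
  isRingₗ = record
    { +-isAbelianGroup = record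
      { isGroup = record
        { isMonoid = record
          { isSemigroup = record
            { isMagma = record
              { isEquivalence = record
                { refl  = pointwise λ _ _ → refl
                ; sym   = λ e → pointwise λ v j → sym (at e v j)
                ; trans = λ e e′ → pointwise λ v j → trans (at e v j) (at e′ v j)
                }
              ; ∙-cong = λ e e′ → pointwise λ v j → +-cong (at e v j) (at e′ v j)
              }
            ; assoc = λ _ _ _ → pointwise λ _ _ → +-assoc _ _ _
            }
          ; identity = (λ _ → pointwise λ _ _ → +-identityˡ _) , (λ _ → pointwise λ _ _ → +-identityʳ _)
          }
        ; inverse = (λ _ → pointwise λ _ _ → -‿inverseˡ _) , (λ _ → pointwise λ _ _ → -‿inverseʳ _)
        ; ⁻¹-cong = λ e → pointwise λ v j → -‿cong (at e v j)
        }
      ; comm = λ _ _ → pointwise λ _ _ → +-comm _ _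
      }
    ; *-cong     = λ {f} {_} {_} {g′} e e′ → pointwise λ v j →
                     trans (apply-cong f (at e′ v) j) (at e (apply g′ v) j)
    ; *-assoc    = λ _ _ _ → pointwise λ _ _ → refl
    ; *-identity = (λ _ → pointwise λ _ _ → refl) , (λ _ → pointwise λ _ _ → refl)
    ; distrib    = (λ f g h → pointwise λ v j → additive f (apply g v) (apply h v) j)
                 , (λ _ _ _ → pointwise λ _ _ → refl)
    }

  End : KAlgebra K
  End = record
    { algRing   = record { isRing = isRingₗ }
    ; ι         = scalar
    ; ι-hom     = record
      { isSemiringHomomorphism = record
        { isNearSemiringHomomorphism = record
          { +-isMonoidHomomorphism = record
            { isMagmaHomomorphism = record
              { isRelHomomorphism = record { cong = λ e → pointwise λ _ _ → *-cong e refl }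
              ; homo              = λ _ _ → pointwise λ _ _ → distribʳ _ _ _
              }
            ; ε-homo = pointwise λ _ _ → zeroˡ _
            }
          ; *-homo = λ _ _ → pointwise λ _ _ → *-assoc _ _ _
          }
        ; 1#-homo = pointwise λ _ _ → *-identityˡ _
        }
      ; -‿homo = λ _ → pointwise λ _ _ → sym (-‿distribˡ-* _ _)
      }
    ; ι-central = λ k f → pointwise λ v j → sym (homogeneous f k v j)
    }
    where open RingProperties ring using (-‿distribˡ-*)

-- For a literal n, numeral 0# 1# _+_ n unfolds to n × 1#, so the Mult lemmas apply directly.
module FieldNumerals (K : Field) where
  open Field K
  open import Algebra.Properties.Semiring.Mult semiring using (×-homo-+; ×1-homo-*)
  open SetoidReasoning setoid

  four : Carrier
  four = (1# + 1#) + (1# + 1#)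

  numeral4≈four : numeral 0# 1# _+_ 4 ≈ four
  numeral4≈four = trans (×-homo-+ 1# 2 2) (+-cong two≈ two≈)
    where
    two≈ : numeral 0# 1# _+_ 2 ≈ 1# + 1#
    two≈ = +-cong refl (+-identityʳ 1#)

  four≉0 : CharZero K → ¬ (four ≈ 0#)
  four≉0 char0 four≈0 = char0 3 (trans numeral4≈four four≈0)

  sixteenth*four≉0 : ∀ {q} → numeral 0# 1# _+_ 16 * q ≈ 1# → ¬ (q * four ≈ 0#)
  sixteenth*four≉0 {q} 16q≈1 q4≈0 = 1≉0 (begin
    1#                      ≈⟨ 16q≈1 ⟨
    numeral 0# 1# _+_ 16 * q ≈⟨ *-cong (trans (×1-homo-* 4 4) (*-cong numeral4≈four numeral4≈four)) refl ⟩
    four * four * q         ≈⟨ *-assoc _ _ _ ⟩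
    four * (four * q)       ≈⟨ *-cong refl (trans (*-comm four q) q4≈0) ⟩
    four * 0#               ≈⟨ zeroʳ four ⟩
    0#                      ∎)

module ThreeDimensionalRepresentation (K : Field) where
  open Field K hiding (zero)
  open RingProperties ring using (-0#≈0#; -‿involutive)
  open import Algebra.Properties.CommutativeSemigroup +-commutativeSemigroup using (interchange)
  open LinearEndomorphisms K 3

  private
    double-additive : ∀ x y → (x + y) + (x + y) ≈ (x + x) + (y + y)
    double-additive x y = interchange x y x y

    double-homogeneous : ∀ k x → k * x + k * x ≈ k * (x + x)
    double-homogeneous k x = sym (distribˡ k x x)

    0≈0+0 : 0# ≈ 0# + 0#
    0≈0+0 = sym (+-identityʳ 0#)

    x-0≈x : ∀ x → x - 0# ≈ x
    x-0≈x x = trans (+-cong refl -0#≈0#) (+-identityʳ x)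

    x-[0+0]≈x : ∀ x → x - (0# + 0#) ≈ x
    x-[0+0]≈x x = trans (+-cong refl (-‿cong (+-identityʳ 0#))) (x-0≈x x)

  hᴸ : Linear
  hᴸ = record
    { apply       = λ where
        v 0F → v 0F + v 0F
        v 1F → 0#
        v 2F → - (v 2F + v 2F)
    ; apply-cong  = λ where
        e 0F → +-cong (e 0F) (e 0F)
        e 1F → refl
        e 2F → -‿cong (+-cong (e 2F) (e 2F))
    ; additive    = λ where
        u v 0F → double-additive _ _
        u v 1F → 0≈0+0
        u v 2F → trans (-‿cong (double-additive _ _)) (sym (-‿+-comm _ _))
    ; homogeneous = λ where
        k u 0F → double-homogeneous _ _
        k u 1F → sym (zeroʳ k)
        k u 2F → trans (-‿cong (double-homogeneous _ _)) (-‿distribʳ-* _ _)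
    }
    where open RingProperties ring using (-‿+-comm; -‿distribʳ-*)

  eᴸ : Linear
  eᴸ = record
    { apply       = λ where
        v 0F → v 1F + v 1F
        v 1F → v 2F
        v 2F → 0#
    ; apply-cong  = λ where
        e 0F → +-cong (e 1F) (e 1F)
        e 1F → e 2F
        e 2F → refl
    ; additive    = λ where
        u v 0F → double-additive _ _
        u v 1F → refl
        u v 2F → 0≈0+0
    ; homogeneous = λ where
        k u 0F → double-homogeneous _ _
        k u 1F → refl
        k u 2F → sym (zeroʳ k)
    }

  fᴸ : Linear
  fᴸ = record
    { apply       = λ where
        v 0F → 0#
        v 1F → v 0F
        v 2F → v 1F + v 1F
    ; apply-cong  = λ where
        e 0F → refl
        e 1F → e 0F
        e 2F → +-cong (e 1F) (e 1F)
    ; additive    = λ where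
        u v 0F → 0≈0+0
        u v 1F → refl
        u v 2F → double-additive _ _
    ; homogeneous = λ where
        k u 0F → sym (zeroʳ k)
        k u 1F → refl
        k u 2F → double-homogeneous _ _
    }

  sl2-rel : Sl2Rel End eᴸ fᴸ hᴸ
  sl2-rel = record
    { HE = pointwise λ where
        v 0F → x-[0+0]≈x _
        v 1F → trans (+-identityˡ _) (-‿involutive _)
        v 2F → trans (x-0≈x _) (trans (-‿cong (+-identityʳ 0#)) (trans -0#≈0# 0≈0+0))
    ; HF = pointwise λ where
        v 0F → trans (x-0≈x _) (trans (+-identityʳ 0#) (trans (sym -0#≈0#) (-‿cong 0≈0+0)))
        v 1F → +-identityˡ _
        v 2F → x-[0+0]≈x _
    ; EF = pointwise λ where
        v 0F → x-0≈x _
        v 1F → -‿inverseʳ _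
        v 2F → +-identityˡ _
    }

  private
    module End = KAlgebra End
    module End′ = KAlgebraProperties End

    𝟙 : Vec
    𝟙 _ = 1#

  open FieldNumerals K

  -h≉h : CharZero K → ¬ (End.- hᴸ End.≈ hᴸ)
  -h≉h char0 -h≈h = four≉0 char0 (trans (+-cong (sym (at -h≈h 𝟙 0F)) refl) (-‿inverseˡ _))

  -- On the vector 𝟙, coordinate 0 gives c ≈ q (four - four), coordinate 1 gives c ≈ q (0 - four).
  scaled-sq-4-h-nonscalar : ∀ {q} → numeral 0# 1# _+_ 16 * q ≈ 1# →
                            ∀ c → ¬ (End.ι c End.≈ End.ι q End.* End′.sq-4 hᴸ)
  scaled-sq-4-h-nonscalar {q} 16q≈1 c c≈ = sixteenth*four≉0 16q≈1 (begin
    q * four             ≈⟨ -‿involutive _ ⟨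
    - - (q * four)       ≈⟨ -‿cong (-‿distribʳ-* q four) ⟩
    - (q * - four)       ≈⟨ -‿cong (*-cong refl (+-identityˡ _)) ⟨
    - (q * (0# - four))  ≈⟨ -‿cong (trans (sym (at c≈′ 𝟙 1F)) (at c≈′ 𝟙 0F)) ⟩
    - (q * (four - four)) ≈⟨ -‿cong (trans (*-cong refl (-‿inverseʳ four)) (zeroʳ q)) ⟩
    - 0#                 ≈⟨ -0#≈0# ⟩
    0#                   ∎)
    where
    open SetoidReasoning setoid
    open RingProperties ring using (-‿distribʳ-*)
    c≈′ : End.ι c End.≈ End.ι q End.* (hᴸ End.* hᴸ End.- End′.two End.* End′.two)
    c≈′ = End.trans c≈ (End.*-cong (End.refl {End.ι q}) (End′.sq-4≈x²-4 hᴸ))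

Sl2Rel-flip : ∀ {K} {A : KAlgebra K} {E F H} → Sl2Rel A E F H → Sl2Rel A F E (KAlgebra.-_ A H)
Sl2Rel-flip {A = A} {E} {F} {H} rel = record
  { HE = trans (neg-commutator H F) (trans (-‿cong HF) (-‿involutive _))
  ; HF = trans (neg-commutator H E) (-‿cong HE)
  ; EF = trans (sym (⁻¹-anti-homo‿- (E * F) (F * E))) (-‿cong EF)
  }
  where
  open KAlgebra A
  open Sl2Rel rel
  open RingProperties algRing
  neg-commutator : ∀ x y → - x * y - y * - x ≈ - (x * y - y * x)
  neg-commutator x y = trans (+-cong (sym (-‿distribˡ-* x y)) (-‿cong (sym (-‿distribʳ-* y x))))
                             (-‿+-comm (x * y) (- (y * x)))

module Usl2Properties {K : Field} {U : KAlgebra K} {E F H : KAlgebra.Carrier U}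
                      (iu : IsUsl2 U E F H) where
  open KAlgebra U
  open KAlgebraProperties U
  open IsUsl2 iu
  private
    module K = Field K
    module Rep = ThreeDimensionalRepresentation K
    open LinearEndomorphisms K 3 using (End)
    module End = KAlgebra End
    module End′ = KAlgebraProperties End
    open SetoidReasoning End.setoid

    ρ : Carrier → End.Carrier
    ρ = proj₁ (lift End Rep.eᴸ Rep.fᴸ Rep.hᴸ Rep.sl2-rel)

    ρ-hom : IsKAlgHom U End ρ
    ρ-hom = proj₁ (proj₂ (lift End Rep.eᴸ Rep.fᴸ Rep.hᴸ Rep.sl2-rel))

    module ρ = KAlgHomProperties ρ-hom

    ρ-H : ρ H End.≈ Rep.hᴸ
    ρ-H = proj₂ (proj₂ (proj₂ (proj₂ (lift End Rep.eᴸ Rep.fᴸ Rep.hᴸ Rep.sl2-rel))))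

  -H≉H : CharZero K → ¬ (- H ≈ H)
  -H≉H char0 -H≈H = Rep.-h≉h char0 (begin
    End.- Rep.hᴸ  ≈⟨ End.-‿cong ρ-H ⟨
    End.- ρ H     ≈⟨ ρ.-‿homo H ⟨
    ρ (- H)       ≈⟨ ρ.⟦⟧-cong -H≈H ⟩
    ρ H           ≈⟨ ρ-H ⟩
    Rep.hᴸ        ∎)

  scaled-sq-4-H-nonscalar : ∀ {q} → numeral K.0# K.1# K._+_ 16 K.* q K.≈ K.1# →
                            ¬ (∃ λ c → ι q * sq-4 H ≈ ι c)
  scaled-sq-4-H-nonscalar {q} 16q≈1 (c , qH≈c) = Rep.scaled-sq-4-h-nonscalar 16q≈1 c (begin
    End.ι c                      ≈⟨ ρ.ι-comm c ⟨
    ρ (ι c)                      ≈⟨ ρ.⟦⟧-cong qH≈c ⟨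
    ρ (ι q * sq-4 H)             ≈⟨ ρ.φ-ι* q (sq-4 H) ⟩
    End.ι q End.* ρ (sq-4 H)     ≈⟨ End.*-cong (End.refl {End.ι q}) (ρ.φ-sq-4 H) ⟩
    End.ι q End.* End′.sq-4 (ρ H) ≈⟨ End.*-cong (End.refl {End.ι q}) (End′.sq-4-cong ρ-H) ⟩
    End.ι q End.* End′.sq-4 Rep.hᴸ ∎)

  σ : Carrier → Carrier
  σ = proj₁ (lift U F E (- H) (Sl2Rel-flip rel))

  σ-hom : IsKAlgHom U U σ
  σ-hom = proj₁ (proj₂ (lift U F E (- H) (Sl2Rel-flip rel)))

  σ-E : σ E ≈ F
  σ-E = proj₁ (proj₂ (proj₂ (lift U F E (- H) (Sl2Rel-flip rel))))

  σ-F : σ F ≈ E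
  σ-F = proj₁ (proj₂ (proj₂ (proj₂ (lift U F E (- H) (Sl2Rel-flip rel)))))

  σ-H : σ H ≈ - H
  σ-H = proj₂ (proj₂ (proj₂ (proj₂ (lift U F E (- H) (Sl2Rel-flip rel)))))

module SharpProperness (K : Field) (i q16 q64 : Field.Carrier K)
                       {U : KAlgebra K} {E F H : KAlgebra.Carrier U} (iu : IsUsl2 U E F H) where
  open KAlgebra U
  open KAlgebraProperties U
  open RingProperties algRing
  open SetoidReasoning setoid
  open Sharp K i q16 q64 U E F H using (gens; InIm; InUe)
  open Usl2Properties iu
  open KAlgHomProperties σ-hom

  σ-gens : ∀ j → σ (gens j) ≈ gens j
  σ-gens 0F = trans (φ-ι* q16 _) (*-cong refl (begin
    σ (sq-4 (E + F))       ≈⟨ φ-sq-4 (E + F) ⟩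
    sq-4 (σ (E + F))       ≈⟨ sq-4-cong (trans (+-homo E F) (+-cong σ-E σ-F)) ⟩
    sq-4 (F + E)           ≈⟨ sq-4-cong (+-comm F E) ⟩
    sq-4 (E + F)           ∎))
  σ-gens 1F = trans (φ-ι* q16 _) (*-cong refl (begin
    σ (sq-4 H)             ≈⟨ φ-sq-4 H ⟩
    sq-4 (σ H)             ≈⟨ sq-4-cong σ-H ⟩
    sq-4 (- H)             ≈⟨ sq-4-neg H ⟩
    sq-4 H                 ∎))
  σ-gens 2F = trans (φ-ι* q16 _) (*-cong refl (begin
    σ (sq-4 (iE - iF))     ≈⟨ φ-sq-4 _ ⟩
    sq-4 (σ (iE - iF))     ≈⟨ sq-4-cong σ[iE-iF] ⟩
    sq-4 (- (iE - iF))     ≈⟨ sq-4-neg _ ⟩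
    sq-4 (iE - iF)         ∎))
    where
    iE iF : Carrier
    iE = ι i * E
    iF = ι i * F
    σ[iE-iF] : σ (iE - iF) ≈ - (iE - iF)
    σ[iE-iF] = trans (φ-sub iE iF)
      (trans (+-cong (trans (φ-ι* i E) (*-cong refl σ-E)) (-‿cong (trans (φ-ι* i F) (*-cong refl σ-F))))
             (sym (⁻¹-anti-homo‿- iE iF)))
  σ-gens 3F = trans (φ-ι* q64 _) (*-cong refl (begin
    σ (P - Q)                                  ≈⟨ φ-sub P Q ⟩
    σ P - σ Q                                  ≈⟨ +-cong (*-homo _ _) (-‿cong (*-homo _ _)) ⟩
    σ (H + two) * σ (F * F) - σ (H - two) * σ (E * E)
      ≈⟨ +-cong (*-cong σ[H+2] (σ-square σ-F)) (-‿cong (*-cong σ[H-2] (σ-square σ-E))) ⟩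
    - (H - two) * (E * E) - - (H + two) * (F * F)
      ≈⟨ +-cong (sym (-‿distribˡ-* _ _)) (-‿cong (sym (-‿distribˡ-* _ _))) ⟩
    - Q - - P                                  ≈⟨ -‿+-comm Q (- P) ⟩
    - (Q - P)                                  ≈⟨ ⁻¹-anti-homo‿- Q P ⟩
    P - Q                                      ∎))
    where
    P Q : Carrier
    P = (H + two) * (F * F)
    Q = (H - two) * (E * E)
    σ-square : ∀ {x y} → σ x ≈ y → σ (x * x) ≈ y * y
    σ-square σx≈y = trans (*-homo _ _) (*-cong σx≈y σx≈y)
    σ[H+2] : σ (H + two) ≈ - (H - two)
    σ[H+2] = trans (+-homo H two) (trans (+-cong σ-H φ-two)
               (trans (+-cong refl (sym (-‿involutive two))) (-‿+-comm H (- two))))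
    σ[H-2] : σ (H - two) ≈ - (H + two)
    σ[H-2] = trans (φ-sub H two) (trans (+-cong σ-H (-‿cong φ-two)) (-‿+-comm H two))

  σ-fixes-Im♯ : ∀ {x} → InIm x → σ x ≈ x
  σ-fixes-Im♯ (scal k)    = ι-comm k
  σ-fixes-Im♯ (gen j)     = σ-gens j
  σ-fixes-Im♯ (add s t)   = trans (+-homo _ _) (+-cong (σ-fixes-Im♯ s) (σ-fixes-Im♯ t))
  σ-fixes-Im♯ (mul s t)   = trans (*-homo _ _) (*-cong (σ-fixes-Im♯ s) (σ-fixes-Im♯ t))
  σ-fixes-Im♯ (resp eq s) = trans (⟦⟧-cong (sym eq)) (trans (σ-fixes-Im♯ s) eq)

  H∉Im♯ : CharZero K → ¬ InIm H
  H∉Im♯ char0 H∈Im♯ = -H≉H char0 (trans (sym σ-H) (σ-fixes-Im♯ H∈Im♯))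

theorem7p8 : (K : Field) → CharZero K →
    (i q16 q64 : Field.Carrier K) →
    Field._≈_ K (Field._*_ K i i) (Field.-_ K (Field.1# K)) →
    Field._≈_ K (Field._*_ K (numeral (Field.0# K) (Field.1# K) (Field._+_ K) 16) q16) (Field.1# K) →
    Field._≈_ K (Field._*_ K (numeral (Field.0# K) (Field.1# K) (Field._+_ K) 64) q64) (Field.1# K) →
    (U : KAlgebra K) (E F H : KAlgebra.Carrier U) → IsUsl2 U E F H →
    (∀ x → Sharp.InIm K i q16 q64 U E F H x → Sharp.InUe K i q16 q64 U E F H x)
    × (∃ λ x → Sharp.InUe K i q16 q64 U E F H x × ¬ Sharp.InIm K i q16 q64 U E F H x)
    × (∃ λ x → Sharp.InIm K i q16 q64 U E F H x × ¬ (∃ λ c → KAlgebra._≈_ U x (KAlgebra.ι U c)))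
theorem7p8 K char0 i q16 q64 _ 16q16≈1 _ U E F H iu =
    Im♯⊆Ue
  , (H , even⇒Ue H-even , H∉Im♯ char0)
  , (Sharp.B♯ K i q16 q64 U E F H , gen 1F , scaled-sq-4-H-nonscalar 16q16≈1)
  where
  open SharpImage K i q16 q64 (IsUsl2.rel iu)
  open ParityGrading (IsUsl2.rel iu) using (H-even)
  open SharpProperness K i q16 q64 iu
  open Usl2Properties iu using (scaled-sq-4-H-nonscalar)
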